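{- If $G$ is a graph of order $n$ with at least $2$ edges, then $\operatorname{fd}(G) \le n-2$.
   Context: All graphs are finite and simple; $N(v)$ denotes the open neighborhood of $v$. For a graph $G=(V,E)$ and an integer $k \ge 1$, a $k$-fair dominating set is a dominating set $D \subseteq V$ such that $|N(v) \cap D| = k$ for every $v \in V \setminus D$ (the set $D = V$ qualifies vacuously). A fair dominating set (FD-set) is a set that is a $k$-fair dominating set for some $k \ge 1$. If $G$ has at least one edge, $\operatorname{fd}(G)$ is the minimum cardinality of an FD-set of $G$; by convention, $\operatorname{fd}(\overline{K_n}) = n$ for the edgeless graph on $n$ vertices. -}

module Defs where

open import Data.Nat using (ℕ; _≤_; _<ᵇ_)
open import Data.Bool using (Bool; true; false; _∧_)
open import Data.Fin using (Fin; toℕ)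
open import Data.Fin.Subset using (Subset; _∈_; _∉_; _∩_; ∣_∣)
open import Data.Vec using (tabulate)
open import Data.List using (map; allFin)
open import Data.Nat.ListAction using (sum)
open import Data.Product using (Σ; ∃; _×_)
open import Relation.Binary.PropositionalEquality using (_≡_)

record Graph (n : ℕ) : Set where
  field
    adj    : Fin n → Fin n → Bool
    symm   : ∀ u v → adj u v ≡ adj v u
    irrefl : ∀ v → adj v v ≡ false
open Graph public

N : ∀ {n} → Graph n → Fin n → Subset n
N G v = tabulate (adj G v)

numEdges : ∀ {n} → Graph n → ℕ
numEdges {n} G =
  sum (map (λ i → ∣ tabulate (λ j → adj G i j ∧ (toℕ i <ᵇ toℕ j)) ∣) (allFin n))

Dominating : ∀ {n} → Graph n → Subset n → Set
Dominating G D = ∀ v → v ∉ D → ∃ λ u → u ∈ D × adj G v u ≡ true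

KFairDominating : ∀ {n} → Graph n → ℕ → Subset n → Set
KFairDominating G k D =
  Dominating G D × (∀ v → v ∉ D → ∣ N G v ∩ D ∣ ≡ k)

FairDominating : ∀ {n} → Graph n → Subset n → Set
FairDominating G D = Σ ℕ λ k → 1 ≤ k × KFairDominating G k D

module Submission where

-- A balanced pair is u ≢ w with |N(u) ∖ {w}| = |N(w) ∖ {u}| = k ≥ 1; for it, V ∖ {u, w} is a
-- k-fair dominating set of size n − 2. To find one, take a set S of non-isolated vertices closed
-- under adjacency: all degrees in S lie in 1 … |S| − 1, so by pigeonhole two vertices u ≢ w of S
-- have equal degree, and they form a balanced pair unless uw is an isolated edge. In that case a
-- second edge of G leaves a non-isolated vertex outside {u, w}, so repeating the argument on the
-- remaining non-isolated vertices yields a balanced pair or a second isolated edge u′w′, and then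
-- u, u′ is a balanced pair.

open import Defs
open import Data.Nat using (ℕ; zero; suc; _≤_; _<_; _∸_; _≤ᵇ_; _<ᵇ_; pred; z≤n; s≤s; s≤s⁻¹; z<s; >-nonZero)
open import Data.Nat.Properties using (≤∧≢⇒<; <ᵇ⇒<)
import Data.Nat.Properties as ℕ
open import Data.Nat.ListAction using (sum)
open import Data.Bool using (true; _∧_)
open import Data.Bool.Properties using (∧-conicalˡ; ∧-conicalʳ; T-≡)
open import Data.Fin using (Fin; zero; suc; toℕ)
open import Data.Fin.Properties using (any?)
import Data.Fin.Properties as Fin
open import Data.Fin.Subset
open import Data.Fin.Subset.Properties
open import Data.List.Properties using (map-tabulate)
import Data.List as List
open import Data.Product using (∃; ∃₂; _×_; _,_; proj₁)
open import Data.Sum using (_⊎_; inj₁; inj₂; [_,_]′)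
open import Data.Vec using (_∷_; []; tabulate; here; there)
open import Data.Vec.Properties using (lookup∘tabulate; lookup⇒[]=; []=⇒lookup)
open import Function using (_∘_; _$_; id; Equivalence)
open import Relation.Nullary using (yes; no; contradiction; _×-dec_)
open import Relation.Binary.PropositionalEquality

private
  variable
    n : ℕ
    x y : Fin n
    p : Subset n

x∈tabulate⁺ : ∀ f → f x ≡ true → x ∈ tabulate f
x∈tabulate⁺ {x = x} f fx = lookup⇒[]= x (tabulate f) (trans (lookup∘tabulate f x) fx)

x∈tabulate⁻ : ∀ f → x ∈ tabulate f → f x ≡ true
x∈tabulate⁻ {x = x} f x∈ = trans (sym (lookup∘tabulate f x)) ([]=⇒lookup x∈)

x∈p⇒∣p∣≡1+∣p-x∣ : x ∈ p → ∣ p ∣ ≡ suc ∣ p - x ∣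
x∈p⇒∣p∣≡1+∣p-x∣ {p = inside ∷ p} here = cong (suc ∘ ∣_∣) (sym (p─⊥≡p p))
x∈p⇒∣p∣≡1+∣p-x∣ {p = inside ∷ p} (there x∈p) = cong suc (x∈p⇒∣p∣≡1+∣p-x∣ x∈p)
x∈p⇒∣p∣≡1+∣p-x∣ {p = outside ∷ p} (there x∈p) = x∈p⇒∣p∣≡1+∣p-x∣ x∈p

x∉p⇒p-x≡p : x ∉ p → p - x ≡ p
x∉p⇒p-x≡p {x = zero} {p = inside ∷ p} x∉p = contradiction here x∉p
x∉p⇒p-x≡p {x = zero} {p = outside ∷ p} x∉p = cong (outside ∷_) (p─⊥≡p p)
x∉p⇒p-x≡p {x = suc x} {p = s ∷ p} x∉p = cong (s ∷_) (x∉p⇒p-x≡p (x∉p ∘ there))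

x∉p-x : ∀ (p : Subset n) x → x ∉ p - x
x∉p-x (s ∷ p) zero ()
x∉p-x (s ∷ p) (suc x) (there x∈p-x) = x∉p-x p x x∈p-x

x∈p-y⇒x≢y : x ∈ p - y → x ≢ y
x∈p-y⇒x≢y {p = p} x∈p-y refl = x∉p-x p _ x∈p-y

p∩[⊤─q]≡p─q : ∀ (p q : Subset n) → p ∩ (⊤ ─ q) ≡ p ─ q
p∩[⊤─q]≡p─q []            []            = refl
p∩[⊤─q]≡p─q (inside  ∷ p) (inside  ∷ q) = cong (outside ∷_) (p∩[⊤─q]≡p─q p q)
p∩[⊤─q]≡p─q (outside ∷ p) (inside  ∷ q) = cong (outside ∷_) (p∩[⊤─q]≡p─q p q)
p∩[⊤─q]≡p─q (inside  ∷ p) (outside ∷ q) = cong (inside ∷_) (p∩[⊤─q]≡p─q p q)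
p∩[⊤─q]≡p─q (outside ∷ p) (outside ∷ q) = cong (outside ∷_) (p∩[⊤─q]≡p─q p q)

0<∣p∣⇒Nonempty : 0 < ∣ p ∣ → Nonempty p
0<∣p∣⇒Nonempty {p = inside ∷ p} _ = zero , here
0<∣p∣⇒Nonempty {p = outside ∷ p} 0<∣p∣ with 0<∣p∣⇒Nonempty 0<∣p∣
... | x , x∈p = suc x , there x∈p

x∈p⇒0<∣p∣ : x ∈ p → 0 < ∣ p ∣
x∈p⇒0<∣p∣ x∈p = subst (0 <_) (sym (x∈p⇒∣p∣≡1+∣p-x∣ x∈p)) z<s

x∈p∧∣p∣≡1⇒p⊆⁅x⁆ : x ∈ p → ∣ p ∣ ≡ 1 → p ⊆ ⁅ x ⁆
x∈p∧∣p∣≡1⇒p⊆⁅x⁆ {x = x} {p = p} x∈p ∣p∣≡1 {y} y∈p with y Fin.≟ x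
... | yes refl = x∈⁅x⁆ x
... | no  y≢x  = contradiction (subst (0 <_) ∣p-x∣≡0 (x∈p⇒0<∣p∣ (x∈p∧x≢y⇒x∈p-y y∈p y≢x))) λ ()
  where
  ∣p-x∣≡0 : ∣ p - x ∣ ≡ 0
  ∣p-x∣≡0 = ℕ.suc-injective (trans (sym (x∈p⇒∣p∣≡1+∣p-x∣ x∈p)) ∣p∣≡1)

Collision : (Fin n → ℕ) → Subset n → Set
Collision f p = ∃₂ λ x y → x ≢ y × x ∈ p × y ∈ p × f x ≡ f y

Collision-mono : ∀ {f} {p q : Subset n} → p ⊆ q → Collision f p → Collision f q
Collision-mono p⊆q (x , y , x≢y , x∈p , y∈p , fx≡fy) = x , y , x≢y , p⊆q x∈p , p⊆q y∈p , fx≡fy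

Collision-pred : ∀ {f} {p : Subset n} → (∀ {x} → x ∈ p → 1 ≤ f x) → Collision (pred ∘ f) p → Collision f p
Collision-pred 1≤f (x , y , x≢y , x∈p , y∈p , eq) =
  x , y , x≢y , x∈p , y∈p , ℕ.pred-injective ⦃ >-nonZero (1≤f x∈p) ⦄ ⦃ >-nonZero (1≤f y∈p) ⦄ eq

pigeonhole : ∀ (f : Fin n → ℕ) b (p : Subset n) → (∀ {x} → x ∈ p → f x < b) → b < ∣ p ∣ →
             Collision f p
pigeonhole f zero p f<0 0<∣p∣ with 0<∣p∣⇒Nonempty 0<∣p∣
... | x , x∈p = contradiction (f<0 x∈p) λ ()
pigeonhole f (suc b) p f<1+b 1+b<∣p∣ with any? (λ x → x ∈? p ×-dec f x ℕ.≟ b)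
... | no none = pigeonhole f b p f<b (ℕ.<-trans (ℕ.n<1+n b) 1+b<∣p∣)
  where
  f<b : ∀ {y} → y ∈ p → f y < b
  f<b y∈p = ≤∧≢⇒< (s≤s⁻¹ (f<1+b y∈p)) λ fy≡b → none (_ , y∈p , fy≡b)
... | yes (x , x∈p , fx≡b) with any? (λ y → y ∈? p - x ×-dec f y ℕ.≟ b)
...   | yes (y , y∈p-x , fy≡b) =
  x , y , (λ x≡y → x∈p-y⇒x≢y y∈p-x (sym x≡y)) , x∈p , p─q⊆p p ⁅ x ⁆ y∈p-x , trans fx≡b (sym fy≡b)
...   | no none = Collision-mono (p─q⊆p p ⁅ x ⁆) (pigeonhole f b (p - x) f<b b<∣p-x∣)
  where
  f<b : ∀ {y} → y ∈ p - x → f y < b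
  f<b y∈p-x = ≤∧≢⇒< (s≤s⁻¹ (f<1+b (p─q⊆p p ⁅ x ⁆ y∈p-x))) λ fy≡b → none (_ , y∈p-x , fy≡b)
  b<∣p-x∣ : b < ∣ p - x ∣
  b<∣p-x∣ = s≤s⁻¹ (subst (suc b <_) (x∈p⇒∣p∣≡1+∣p-x∣ x∈p) 1+b<∣p∣)

∣p-x-y∣≡∣p∣∸2 : x ∈ p → y ∈ p → x ≢ y → ∣ p - x - y ∣ ≡ ∣ p ∣ ∸ 2
∣p-x-y∣≡∣p∣∸2 {x = x} {p = p} {y = y} x∈p y∈p x≢y = sym (cong (_∸ 2) (begin
  ∣ p ∣                ≡⟨ x∈p⇒∣p∣≡1+∣p-x∣ x∈p ⟩
  suc ∣ p - x ∣        ≡⟨ cong suc (x∈p⇒∣p∣≡1+∣p-x∣ (x∈p∧x≢y⇒x∈p-y y∈p (x≢y ∘ sym))) ⟩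
  suc (suc ∣ p - x - y ∣) ∎))
  where open ≡-Reasoning

x∈p-y-z⁻ : ∀ {z} → x ∈ p - y - z → x ∈ p × x ≢ y × x ≢ z
x∈p-y-z⁻ {p = p} {y = y} {z = z} x∈p-y-z =
  p─q⊆p p ⁅ y ⁆ (p─q⊆p (p - y) ⁅ z ⁆ x∈p-y-z) ,
  x∈p-y⇒x≢y (p─q⊆p (p - y) ⁅ z ⁆ x∈p-y-z) ,
  x∈p-y⇒x≢y x∈p-y-z

x∈p-y-z⁺ : ∀ {z} → x ∈ p → x ≢ y → x ≢ z → x ∈ p - y - z
x∈p-y-z⁺ x∈p x≢y x≢z = x∈p∧x≢y⇒x∈p-y (x∈p∧x≢y⇒x∈p-y x∈p x≢y) x≢z

x∈p∧x∉p-y-z⇒x≡y⊎x≡z : ∀ {z} → x ∈ p → x ∉ p - y - z → x ≡ y ⊎ x ≡ z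
x∈p∧x∉p-y-z⇒x≡y⊎x≡z {x = x} {y = y} {z = z} x∈p x∉ with x Fin.≟ y | x Fin.≟ z
... | yes x≡y | _       = inj₁ x≡y
... | no _    | yes x≡z = inj₂ x≡z
... | no x≢y  | no x≢z  = contradiction (x∈p-y-z⁺ x∈p x≢y x≢z) x∉

orient : ∀ {a b u w : Fin n} → toℕ a < toℕ b → a ≡ u ⊎ a ≡ w → b ≡ u ⊎ b ≡ w →
         (a ≡ u × b ≡ w) ⊎ (a ≡ w × b ≡ u)
orient a<b (inj₁ refl) (inj₁ refl) = contradiction a<b (ℕ.<-irrefl refl)
orient _   (inj₁ a≡u)  (inj₂ b≡w)  = inj₁ (a≡u , b≡w)
orient _   (inj₂ a≡w)  (inj₁ b≡u)  = inj₂ (a≡w , b≡u)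
orient a<b (inj₂ refl) (inj₂ refl) = contradiction a<b (ℕ.<-irrefl refl)

orderedPairsWithin⇒≡ : ∀ {a b c d u w : Fin n} → toℕ a < toℕ b → toℕ c < toℕ d →
                       a ≡ u ⊎ a ≡ w → b ≡ u ⊎ b ≡ w → c ≡ u ⊎ c ≡ w → d ≡ u ⊎ d ≡ w →
                       a ≡ c × b ≡ d
orderedPairsWithin⇒≡ a<b c<d a∈ b∈ c∈ d∈ with orient a<b a∈ b∈ | orient c<d c∈ d∈
... | inj₁ (refl , refl) | inj₁ (refl , refl) = refl , refl
... | inj₂ (refl , refl) | inj₂ (refl , refl) = refl , refl
... | inj₁ (refl , refl) | inj₂ (refl , refl) = contradiction c<d (ℕ.<-asym a<b)
... | inj₂ (refl , refl) | inj₁ (refl , refl) = contradiction c<d (ℕ.<-asym a<b)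

2≤∣p∣⇒distinct : ∀ {p : Subset n} → 2 ≤ ∣ p ∣ → ∃₂ λ x y → x ≢ y × x ∈ p × y ∈ p
2≤∣p∣⇒distinct {p = p} 2≤∣p∣ with 0<∣p∣⇒Nonempty (ℕ.<-trans z<s 2≤∣p∣)
... | x , x∈p with 0<∣p∣⇒Nonempty (s≤s⁻¹ (subst (2 ≤_) (x∈p⇒∣p∣≡1+∣p-x∣ x∈p) 2≤∣p∣))
... | y , y∈p-x = x , y , (λ x≡y → x∈p-y⇒x≢y y∈p-x (sym x≡y)) , x∈p , p─q⊆p p ⁅ x ⁆ y∈p-x

1≤sum⇒∃1≤ : ∀ (h : Fin n → ℕ) → 1 ≤ sum (List.tabulate h) → ∃ λ i → 1 ≤ h i
1≤sum⇒∃1≤ {suc n} h 1≤Σ with h zero in h₀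
... | suc _ = zero , subst (1 ≤_) (sym h₀) (s≤s z≤n)
... | zero with 1≤sum⇒∃1≤ (h ∘ suc) 1≤Σ
...   | i , 1≤hi = suc i , 1≤hi

2≤sum⇒∃2≤⊎∃₂1≤ : ∀ (h : Fin n → ℕ) → 2 ≤ sum (List.tabulate h) →
                  (∃ λ i → 2 ≤ h i) ⊎ (∃₂ λ i j → i ≢ j × 1 ≤ h i × 1 ≤ h j)
2≤sum⇒∃2≤⊎∃₂1≤ {suc n} h 2≤Σ with h zero in h₀
... | suc (suc _) = inj₁ (zero , subst (2 ≤_) (sym h₀) (s≤s (s≤s z≤n)))
... | suc zero with 1≤sum⇒∃1≤ (h ∘ suc) (s≤s⁻¹ 2≤Σ)
...   | j , 1≤hj = inj₂ (zero , suc j , (λ ()) , subst (1 ≤_) (sym h₀) ℕ.≤-refl , 1≤hj)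
2≤sum⇒∃2≤⊎∃₂1≤ {suc n} h 2≤Σ | zero with 2≤sum⇒∃2≤⊎∃₂1≤ (h ∘ suc) 2≤Σ
...   | inj₁ (i , 2≤hi) = inj₁ (suc i , 2≤hi)
...   | inj₂ (i , j , i≢j , 1≤hi , 1≤hj) = inj₂ (suc i , suc j , i≢j ∘ Fin.suc-injective , 1≤hi , 1≤hj)

module _ {n : ℕ} (G : Graph n) where

  private
    variable
      u v w : Fin n
      S : Subset n

  deg : Fin n → ℕ
  deg v = ∣ N G v ∣

  ∈N⁺ : adj G v x ≡ true → x ∈ N G v
  ∈N⁺ {v} = x∈tabulate⁺ (adj G v)

  ∈N⁻ : x ∈ N G v → adj G v x ≡ true
  ∈N⁻ {v = v} = x∈tabulate⁻ (adj G v)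

  N-sym : x ∈ N G v → v ∈ N G x
  N-sym {x} {v} x∈Nv = ∈N⁺ (trans (symm G x v) (∈N⁻ x∈Nv))

  v∉N[v] : v ∉ N G v
  v∉N[v] {v} v∈Nv with trans (sym (∈N⁻ v∈Nv)) (irrefl G v)
  ... | ()

  BalancedPair : Fin n → Fin n → Set
  BalancedPair u w = u ≢ w × ∣ N G u - w ∣ ≡ ∣ N G w - u ∣ × 1 ≤ ∣ N G u - w ∣

  N∩[⊤-x-v]≡N-x : ∀ x v → N G v ∩ (⊤ - x - v) ≡ N G v - x
  N∩[⊤-x-v]≡N-x x v = begin
    N G v ∩ (⊤ - x - v)            ≡⟨ cong (N G v ∩_) (p─q─r≡p─q∪r ⊤ ⁅ x ⁆ ⁅ v ⁆) ⟩
    N G v ∩ (⊤ ─ (⁅ x ⁆ ∪ ⁅ v ⁆))  ≡⟨ p∩[⊤─q]≡p─q (N G v) (⁅ x ⁆ ∪ ⁅ v ⁆) ⟩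
    N G v ─ (⁅ x ⁆ ∪ ⁅ v ⁆)        ≡⟨ p─q─r≡p─q∪r (N G v) ⁅ x ⁆ ⁅ v ⁆ ⟨
    N G v - x - v                  ≡⟨ x∉p⇒p-x≡p (v∉N[v] ∘ p─q⊆p (N G v) ⁅ x ⁆) ⟩
    N G v - x                      ∎
    where open ≡-Reasoning

  BalancedPair⇒FairDominating : BalancedPair u w → FairDominating G (⊤ - u - w)
  BalancedPair⇒FairDominating {u} {w} (_ , balanced , 1≤k) = ∣ N G u - w ∣ , 1≤k , dominating , fair
    where
    fair : ∀ v → v ∉ ⊤ - u - w → ∣ N G v ∩ (⊤ - u - w) ∣ ≡ ∣ N G u - w ∣
    fair v v∉D with x∈p∧x∉p-y-z⇒x≡y⊎x≡z ∈⊤ v∉D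
    ... | inj₁ refl = cong ∣_∣ (trans (cong (N G v ∩_) (p─x─y≡p─y─x ⊤ u w)) (N∩[⊤-x-v]≡N-x w u))
    ... | inj₂ refl = trans (cong ∣_∣ (N∩[⊤-x-v]≡N-x u w)) (sym balanced)
    dominating : Dominating G (⊤ - u - w)
    dominating v v∉D with 0<∣p∣⇒Nonempty (subst (1 ≤_) (sym (fair v v∉D)) 1≤k)
    ... | x , x∈N∩D with x∈p∩q⁻ (N G v) (⊤ - u - w) x∈N∩D
    ...   | x∈N , x∈D = x , x∈D , ∈N⁻ x∈N

  Closed : Subset n → Set
  Closed S = ∀ {x y} → x ∈ S → y ∈ N G x → y ∈ S

  deg<∣S∣ : Closed S → x ∈ S → deg x < ∣ S ∣
  deg<∣S∣ {S} {x} closed x∈S =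
    subst (deg x <_) (sym (x∈p⇒∣p∣≡1+∣p-x∣ x∈S)) (s≤s (p⊆q⇒∣p∣≤∣q∣ N[x]⊆S-x))
    where
    N[x]⊆S-x : N G x ⊆ S - x
    N[x]⊆S-x y∈N = x∈p∧x≢y⇒x∈p-y (closed x∈S y∈N) λ { refl → v∉N[v] y∈N }

  equalDegrees : Closed S → (∀ {x} → x ∈ S → 1 ≤ deg x) → Nonempty S → Collision deg S
  equalDegrees {S} closed 1≤deg (x₀ , x₀∈S) =
    Collision-pred 1≤deg (pigeonhole (pred ∘ deg) ∣ S - x₀ ∣ S pred[deg]<∣S-x₀∣ (x∈p⇒∣p-x∣<∣p∣ x₀∈S))
    where
    pred[deg]<∣S-x₀∣ : ∀ {x} → x ∈ S → pred (deg x) < ∣ S - x₀ ∣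
    pred[deg]<∣S-x₀∣ x∈S = subst (_ <_) (cong pred (x∈p⇒∣p∣≡1+∣p-x∣ x₀∈S))
      (ℕ.pred-mono-< ⦃ >-nonZero (1≤deg x∈S) ⦄ (deg<∣S∣ closed x∈S))

  x∈N[v]⇒x≢v : x ∈ N G v → x ≢ v
  x∈N[v]⇒x≢v x∈N refl = v∉N[v] x∈N

  nonadjacent⇒BalancedPair : u ≢ w → w ∉ N G u → deg u ≡ deg w → 1 ≤ deg u → BalancedPair u w
  nonadjacent⇒BalancedPair {u} {w} u≢w w∉N[u] deg≡ 1≤deg =
    u≢w , ∣N[u]-w∣≡∣N[w]-u∣ , subst (1 ≤_) (sym N[u]-w≡N[u]) 1≤deg
    where
    N[u]-w≡N[u] : ∣ N G u - w ∣ ≡ deg u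
    N[u]-w≡N[u] = cong ∣_∣ (x∉p⇒p-x≡p w∉N[u])
    ∣N[u]-w∣≡∣N[w]-u∣ : ∣ N G u - w ∣ ≡ ∣ N G w - u ∣
    ∣N[u]-w∣≡∣N[w]-u∣ = begin
      ∣ N G u - w ∣  ≡⟨ N[u]-w≡N[u] ⟩
      deg u          ≡⟨ deg≡ ⟩
      deg w          ≡⟨ cong ∣_∣ (x∉p⇒p-x≡p (w∉N[u] ∘ N-sym)) ⟨
      ∣ N G w - u ∣  ∎
      where open ≡-Reasoning

  adjacent⇒BalancedPair : w ∈ N G u → deg u ≡ deg w → 2 ≤ deg u → BalancedPair u w
  adjacent⇒BalancedPair {w} {u} w∈N[u] deg≡ 2≤deg =
    x∈N[v]⇒x≢v w∈N[u] ∘ sym ,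
    ℕ.suc-injective (begin
      suc ∣ N G u - w ∣  ≡⟨ x∈p⇒∣p∣≡1+∣p-x∣ w∈N[u] ⟨
      deg u              ≡⟨ deg≡ ⟩
      deg w              ≡⟨ x∈p⇒∣p∣≡1+∣p-x∣ (N-sym w∈N[u]) ⟩
      suc ∣ N G w - u ∣  ∎) ,
    s≤s⁻¹ (subst (2 ≤_) (x∈p⇒∣p∣≡1+∣p-x∣ w∈N[u]) 2≤deg)
    where open ≡-Reasoning

  IsolatedEdge : Fin n → Fin n → Set
  IsolatedEdge u w = w ∈ N G u × deg u ≡ 1 × deg w ≡ 1

  IsolatedEdge-sym : IsolatedEdge u w → IsolatedEdge w u
  IsolatedEdge-sym (w∈N[u] , deg[u]≡1 , deg[w]≡1) = N-sym w∈N[u] , deg[w]≡1 , deg[u]≡1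

  IsolatedEdge-onlyNeighbour : IsolatedEdge u w → x ∈ N G u → x ≡ w
  IsolatedEdge-onlyNeighbour {w = w} (w∈N[u] , deg[u]≡1 , _) x∈N[u] =
    x∈⁅y⁆⇒x≡y w (x∈p∧∣p∣≡1⇒p⊆⁅x⁆ w∈N[u] deg[u]≡1 x∈N[u])

  equalDegrees⇒BalancedPair⊎IsolatedEdge :
    u ≢ w → deg u ≡ deg w → 1 ≤ deg u → BalancedPair u w ⊎ IsolatedEdge u w
  equalDegrees⇒BalancedPair⊎IsolatedEdge {u} {w} u≢w deg≡ 1≤deg with w ∈? N G u
  ... | no  w∉N[u] = inj₁ (nonadjacent⇒BalancedPair u≢w w∉N[u] deg≡ 1≤deg)
  ... | yes w∈N[u] with ℕ.m≤n⇒m<n∨m≡n 1≤deg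
  ...   | inj₁ 2≤deg  = inj₁ (adjacent⇒BalancedPair w∈N[u] deg≡ 2≤deg)
  ...   | inj₂ 1≡deg  = inj₂ (w∈N[u] , sym 1≡deg , trans (sym deg≡) (sym 1≡deg))

  twoIsolatedEdges⇒BalancedPair : ∀ {u′ w′} → IsolatedEdge u w → IsolatedEdge u′ w′ →
                                  u′ ≢ u → u′ ≢ w → BalancedPair u u′
  twoIsolatedEdges⇒BalancedPair e@(_ , deg[u]≡1 , _) (_ , deg[u′]≡1 , _) u′≢u u′≢w =
    nonadjacent⇒BalancedPair (u′≢u ∘ sym) (u′≢w ∘ IsolatedEdge-onlyNeighbour e) (trans deg[u]≡1 (sym deg[u′]≡1))
      (subst (1 ≤_) (sym deg[u]≡1) ℕ.≤-refl)

  Closed-removeIsolatedEdge : Closed S → IsolatedEdge u w → Closed (S - u - w)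
  Closed-removeIsolatedEdge {u = u} {w} closed e {x} {y} x∈S-u-w y∈N[x] with x∈p-y-z⁻ x∈S-u-w
  ... | x∈S , x≢u , x≢w = x∈p-y-z⁺ (closed x∈S y∈N[x]) y≢u y≢w
    where
    y≢u : y ≢ u
    y≢u refl = x≢w (IsolatedEdge-onlyNeighbour e (N-sym y∈N[x]))
    y≢w : y ≢ w
    y≢w refl = x≢u (IsolatedEdge-onlyNeighbour (IsolatedEdge-sym e) (N-sym y∈N[x]))

  nonIsolated : Subset n
  nonIsolated = tabulate (λ v → 1 ≤ᵇ deg v)

  ∈nonIsolated⁺ : 1 ≤ deg v → v ∈ nonIsolated
  ∈nonIsolated⁺ 1≤deg = x∈tabulate⁺ _ (Equivalence.to T-≡ (ℕ.≤⇒≤ᵇ 1≤deg))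

  ∈nonIsolated⁻ : v ∈ nonIsolated → 1 ≤ deg v
  ∈nonIsolated⁻ {v} v∈ = ℕ.≤ᵇ⇒≤ 1 (deg v) (Equivalence.from T-≡ (x∈tabulate⁻ _ v∈))

  Closed-nonIsolated : Closed nonIsolated
  Closed-nonIsolated _ y∈N[x] = ∈nonIsolated⁺ (x∈p⇒0<∣p∣ (N-sym y∈N[x]))

  Edge : Fin n → Fin n → Set
  Edge a b = b ∈ N G a × toℕ a < toℕ b

  -- numEdges G sums ∣ upperN a ∣ over all a.
  upperN : Fin n → Subset n
  upperN a = tabulate (λ b → adj G a b ∧ (toℕ a <ᵇ toℕ b))

  ∈upperN⇒Edge : ∀ {a b} → b ∈ upperN a → Edge a b
  ∈upperN⇒Edge {a} {b} b∈ =
    ∈N⁺ (∧-conicalˡ _ _ adj∧<) , <ᵇ⇒< (toℕ a) (toℕ b) (Equivalence.from T-≡ (∧-conicalʳ _ _ adj∧<))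
    where
    adj∧< : adj G a b ∧ (toℕ a <ᵇ toℕ b) ≡ true
    adj∧< = x∈tabulate⁻ _ b∈

  twoEdges : 2 ≤ numEdges G → ∃₂ λ a b → ∃₂ λ c d → Edge a b × Edge c d × (a ≢ c ⊎ b ≢ d)
  twoEdges 2≤m
    with 2≤sum⇒∃2≤⊎∃₂1≤ (∣_∣ ∘ upperN) (subst (2 ≤_) (cong sum (map-tabulate id (∣_∣ ∘ upperN))) 2≤m)
  ... | inj₁ (a , 2≤∣upperN∣) with 2≤∣p∣⇒distinct 2≤∣upperN∣
  ...   | b , b′ , b≢b′ , b∈ , b′∈ = a , b , a , b′ , ∈upperN⇒Edge b∈ , ∈upperN⇒Edge b′∈ , inj₂ b≢b′
  twoEdges 2≤m | inj₂ (a , c , a≢c , 1≤∣upperN[a]∣ , 1≤∣upperN[c]∣)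
    with 0<∣p∣⇒Nonempty 1≤∣upperN[a]∣ | 0<∣p∣⇒Nonempty 1≤∣upperN[c]∣
  ... | b , b∈ | d , d∈ = a , b , c , d , ∈upperN⇒Edge b∈ , ∈upperN⇒Edge d∈ , inj₁ a≢c

  x∉nonIsolated-u-w⇒x≡u⊎x≡w : y ∈ N G x → x ∉ nonIsolated - u - w → x ≡ u ⊎ x ≡ w
  x∉nonIsolated-u-w⇒x≡u⊎x≡w y∈N[x] = x∈p∧x∉p-y-z⇒x≡y⊎x≡z (∈nonIsolated⁺ (x∈p⇒0<∣p∣ y∈N[x]))

  Nonempty[nonIsolated-u-w] : ∀ {a b c d} u w → Edge a b → Edge c d → a ≢ c ⊎ b ≢ d →
                              Nonempty (nonIsolated - u - w)
  Nonempty[nonIsolated-u-w] {a} {b} {c} {d} u w (b∈N[a] , a<b) (d∈N[c] , c<d) distinct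
    with a ∈? nonIsolated - u - w | b ∈? nonIsolated - u - w
       | c ∈? nonIsolated - u - w | d ∈? nonIsolated - u - w
  ... | yes a∈ | _      | _      | _      = a , a∈
  ... | _      | yes b∈ | _      | _      = b , b∈
  ... | _      | _      | yes c∈ | _      = c , c∈
  ... | _      | _      | _      | yes d∈ = d , d∈
  ... | no a∉  | no b∉  | no c∉  | no d∉
    with orderedPairsWithin⇒≡ a<b c<d
           (x∉nonIsolated-u-w⇒x≡u⊎x≡w b∈N[a] a∉) (x∉nonIsolated-u-w⇒x≡u⊎x≡w (N-sym b∈N[a]) b∉)
           (x∉nonIsolated-u-w⇒x≡u⊎x≡w d∈N[c] c∉) (x∉nonIsolated-u-w⇒x≡u⊎x≡w (N-sym d∈N[c]) d∉)
  ...   | a≡c , b≡d = contradiction distinct [ _$ a≡c , _$ b≡d ]′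

  balancedPair⊎isolatedEdge : Closed S → (∀ {x} → x ∈ S → 1 ≤ deg x) → Nonempty S →
                              (∃₂ BalancedPair) ⊎ (∃₂ λ u w → u ∈ S × IsolatedEdge u w)
  balancedPair⊎isolatedEdge closed 1≤deg nonempty with equalDegrees closed 1≤deg nonempty
  ... | u , w , u≢w , u∈S , _ , deg≡ with equalDegrees⇒BalancedPair⊎IsolatedEdge u≢w deg≡ (1≤deg u∈S)
  ...   | inj₁ balanced = inj₁ (u , w , balanced)
  ...   | inj₂ isolated = inj₂ (u , w , u∈S , isolated)

  balancedPair : 2 ≤ numEdges G → ∃₂ BalancedPair
  balancedPair 2≤m with twoEdges 2≤m
  ... | a , b , c , d , ab , cd , distinct
    with balancedPair⊎isolatedEdge Closed-nonIsolated ∈nonIsolated⁻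
           (a , ∈nonIsolated⁺ (x∈p⇒0<∣p∣ (proj₁ ab)))
  ... | inj₁ balanced = balanced
  ... | inj₂ (u , w , _ , uw)
    with balancedPair⊎isolatedEdge (Closed-removeIsolatedEdge Closed-nonIsolated uw)
           (∈nonIsolated⁻ ∘ proj₁ ∘ x∈p-y-z⁻) (Nonempty[nonIsolated-u-w] u w ab cd distinct)
  ...   | inj₁ balanced = balanced
  ...   | inj₂ (u′ , w′ , u′∈ , u′w′) with x∈p-y-z⁻ u′∈
  ...     | _ , u′≢u , u′≢w = u , u′ , twoIsolatedEdges⇒BalancedPair uw u′w′ u′≢u u′≢w

corollary1 : ∀ (n : ℕ) (G : Graph n) → 2 ≤ numEdges G →
    ∃ λ (D : Subset n) → FairDominating G D × ∣ D ∣ ≤ n ∸ 2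
corollary1 n G 2≤m with balancedPair G 2≤m
... | u , w , balanced@(u≢w , _) =
  ⊤ - u - w ,
  BalancedPair⇒FairDominating G balanced ,
  ℕ.≤-reflexive (trans (∣p-x-y∣≡∣p∣∸2 ∈⊤ ∈⊤ u≢w) (cong (_∸ 2) (∣⊤∣≡n n)))
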